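{- Let $(K,\tau)$ be a field with a gt-henselian field topology. For any $n\ge 2$ and any $\tau$-neighborhood $U$ of $-1$, there is a $\tau$-neighborhood $V$ of $0$ such that if $c_0,\ldots,c_{n-2}\in V$, then the polynomial $X^n+X^{n-1}+c_{n-2}X^{n-2}+\cdots+c_1X+c_0$ has a simple root in $U$.
   Context: Field topologies are assumed to be Hausdorff and non-discrete. A field topology $\tau$ on $K$ is gt-henselian if for every $n\ge 2$ and every $\tau$-neighborhood $U$ of $-1$ there is a $\tau$-neighborhood $V$ of $0$ such that whenever $c_0,\ldots,c_{n-2}\in V$, the polynomial $X^n+X^{n-1}+c_{n-2}X^{n-2}+\cdots+c_1X+c_0$ has a root in $U$. -}

module Defs where

open import Level using (Level; _⊔_) renaming (suc to lsuc)
open import Data.Nat using (ℕ; zero; suc) renaming (_+_ to _+ℕ_)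
open import Data.Fin using (Fin; zero; suc)
open import Data.Product using (Σ; ∃; ∃-syntax; _×_; _,_)
open import Data.Empty using (⊥)
open import Relation.Nullary using (¬_)
open import Relation.Unary using (Pred; _∈_; _⊆_)
open import Relation.Binary.PropositionalEquality using (_≡_; _≢_)
import Data.Unit
open import Algebra.Structures using (IsCommutativeRing)
import Data.Vec.Functional as VF

record Field (c : Level) : Set (lsuc c) where
  infixl 6 _+_ _-_
  infixl 7 _*_
  field
    Carrier : Set c
    _+_ _*_ : Carrier → Carrier → Carrier
    -_      : Carrier → Carrier
    0# 1#   : Carrier
    isCommutativeRing : IsCommutativeRing _≡_ _+_ _*_ -_ 0# 1#
    0≢1     : 0# ≢ 1#
    inverse : ∀ x → x ≢ 0# → ∃[ y ] (x * y ≡ 1#)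

  _-_ : Carrier → Carrier → Carrier
  x - y = x + (- y)

module _ {c : Level} (F : Field c) where
  open Field F

  record FieldTopology (ℓ : Level) : Set (lsuc c ⊔ lsuc ℓ) where
    field
      IsOpen : Pred Carrier c → Set ℓ
      open-univ  : IsOpen (λ _ → Level.Lift c Data.Unit.⊤)
      open-union : ∀ {I : Set c} (O : I → Pred Carrier c) →
                   (∀ i → IsOpen (O i)) → IsOpen (λ x → ∃[ i ] (x ∈ O i))
      open-inter : ∀ O₁ O₂ → IsOpen O₁ → IsOpen O₂ →
                   IsOpen (λ x → x ∈ O₁ × x ∈ O₂)

    Nbhd : Carrier → Pred Carrier c → Set (lsuc c ⊔ ℓ)
    Nbhd x U = ∃[ O ] (IsOpen O × x ∈ O × O ⊆ U)

    field
      hausdorff   : ∀ x y → x ≢ y →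
                    ∃[ U ] ∃[ V ] (IsOpen U × IsOpen V × x ∈ U × y ∈ V ×
                                   (∀ z → z ∈ U → z ∈ V → ⊥))
      nonDiscrete : ¬ (∀ (S : Pred Carrier c) → IsOpen S)
      cont-+ : ∀ x y W → Nbhd (x + y) W →
               ∃[ U ] ∃[ V ] (Nbhd x U × Nbhd y V ×
                              (∀ u v → u ∈ U → v ∈ V → (u + v) ∈ W))
      cont-* : ∀ x y W → Nbhd (x * y) W →
               ∃[ U ] ∃[ V ] (Nbhd x U × Nbhd y V ×
                              (∀ u v → u ∈ U → v ∈ V → (u * v) ∈ W))
      cont-neg : ∀ x W → Nbhd (- x) W →
                 ∃[ U ] (Nbhd x U × (∀ u → u ∈ U → (- u) ∈ W))
      -- inversion is continuous on K \ {0}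
      cont-inv : ∀ x y → x * y ≡ 1# → ∀ W → Nbhd y W →
                 ∃[ U ] (Nbhd x U ×
                         (∀ u v → u ∈ U → u * v ≡ 1# → v ∈ W))

-- Polynomials as coefficient vectors, lowest degree first

  eval : ∀ {m} → (Fin m → Carrier) → Carrier → Carrier
  eval {zero}  f x = 0#
  eval {suc m} f x = f zero + x * eval (λ i → f (suc i)) x

  extend : ∀ {m} → (Fin m → Carrier) → Fin (suc m) → Carrier
  extend {zero}  g _       = 0#
  extend {suc m} g zero    = g zero
  extend {suc m} g (suc i) = extend (λ j → g (suc j)) i

  mulXminus : ∀ {m} → Carrier → (Fin m → Carrier) → Fin (suc m) → Carrier
  mulXminus a g i = (0# VF.∷ g) i - a * extend g i

  Root : ∀ {m} → (Fin m → Carrier) → Carrier → Set c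
  Root f a = eval f a ≡ 0#

  SimpleRoot : ∀ {m} → (Fin (suc m) → Carrier) → Carrier → Set c
  SimpleRoot {m} f a =
    ∃[ g ] ((∀ i → f i ≡ mulXminus a g i) × eval {m} g a ≢ 0#)

  -- coefficients of X^(k+2) + X^(k+1) + c_k X^k + ... + c_1 X + c_0
  -- (so n = k + 2 and cs = (c_0, ..., c_{n-2}))
  specialPoly : ∀ {k} → (Fin (suc k) → Carrier) → Fin (suc k +ℕ 2) → Carrier
  specialPoly cs = cs VF.++ (1# VF.∷ (1# VF.∷ VF.[]))

  GtHenselian : ∀ {ℓ} → FieldTopology ℓ → Set (lsuc c ⊔ ℓ)
  GtHenselian T =
    ∀ (k : ℕ) (U : Pred Carrier c) → Nbhd (- 1#) U →
    ∃[ V ] (Nbhd 0# V ×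
            (∀ (cs : Fin (suc k) → Carrier) → (∀ i → cs i ∈ V) →
             ∃[ x ] (x ∈ U × Root (specialPoly cs) x)))
    where open FieldTopology T

{-# OPTIONS --safe #-}
-- For c = 0 the polynomial is X^(n-1)·(X + 1), so −1 is a simple root: the cofactor
-- X^(n-1) is ±1 there. The cofactor of a root x of f — the quotient f / (X − x)
-- evaluated at x — is a polynomial, hence continuous, function of x and of the
-- coefficients of f, so by Hausdorffness it stays nonzero on a neighbourhood of
-- (−1, 0, …, 0). Shrinking U to that neighbourhood before applying gt-henselianity,
-- the root it provides is therefore simple.
module Submission where

open import Defs
open import Level using (Level; Lift; lift)
open import Data.Nat using (ℕ; zero; suc) renaming (_+_ to _+ℕ_)
open import Data.Fin using (Fin; zero; suc; splitAt; _≟_)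
open import Data.Product using (∃-syntax; _×_; _,_; proj₁; proj₂)
open import Data.Sum using (inj₁; inj₂)
open import Data.Unit using (⊤; tt)
open import Data.Empty using (⊥-elim)
open import Relation.Nullary using (yes; no)
open import Function using (_∘_)
open import Relation.Unary using (Pred; _∈_; _⊆_; _∩_; ⋂)
open import Relation.Binary.PropositionalEquality
open import Algebra.Bundles using (CommutativeRing)
import Algebra.Properties.Ring as RingProperties
import Data.Vec.Functional as VF
open VF using (Vector; _∷_; []; head; tail; _++_)

replicate-++-suc : ∀ {a} {A : Set a} {m n} (x : A) (ys : Vector A n) →
                   VF.replicate (suc m) x ++ ys ≗ x ∷ (VF.replicate m x ++ ys)
replicate-++-suc         x ys zero = refl
replicate-++-suc {m = m} x ys (suc i) with splitAt m i
... | inj₁ _ = refl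
... | inj₂ _ = refl

module Polynomials {c : Level} (F : Field c) where
  open Field F

  commutativeRing : CommutativeRing c c
  commutativeRing = record { isCommutativeRing = isCommutativeRing }

  open CommutativeRing commutativeRing
    using ( +-identityˡ; +-identityʳ; -‿inverseʳ
          ; *-identityʳ; *-assoc; *-comm; zeroˡ; zeroʳ; ring)
  open RingProperties ring using (-0#≈0#; -‿involutive; +-inverseˡ-unique; //-rightDividesʳ)
  open ≡-Reasoning

  -1≢0 : - 1# ≢ 0#
  -1≢0 -1≡0 = 0≢1 (begin
    0#       ≡⟨ sym -0#≈0# ⟩
    - 0#     ≡⟨ cong -_ (sym -1≡0) ⟩
    - (- 1#) ≡⟨ -‿involutive 1# ⟩
    1#       ∎)

  *-nonzero : ∀ {x y} → x ≢ 0# → y ≢ 0# → x * y ≢ 0#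
  *-nonzero {x} {y} x≢0 y≢0 xy≡0 = y≢0 (begin
    y              ≡⟨ sym (*-identityʳ y) ⟩
    y * 1#         ≡⟨ cong (y *_) (sym xx⁻¹≡1) ⟩
    y * (x * x⁻¹)  ≡⟨ sym (*-assoc y x x⁻¹) ⟩
    y * x * x⁻¹    ≡⟨ cong (_* x⁻¹) (trans (*-comm y x) xy≡0) ⟩
    0# * x⁻¹       ≡⟨ zeroˡ x⁻¹ ⟩
    0#             ∎)
    where
    x⁻¹ = proj₁ (inverse x x≢0)
    xx⁻¹≡1 = proj₂ (inverse x x≢0)

  Poly : ℕ → Set c
  Poly = Vector Carrier

  eval-cong : ∀ {m} {f g : Poly m} → f ≗ g → ∀ a → eval F f a ≡ eval F g a
  eval-cong {zero}  f≗g a = refl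
  eval-cong {suc m} f≗g a =
    cong₂ (λ u v → u + a * v) (f≗g zero) (eval-cong (λ i → f≗g (suc i)) a)

  -- Synthetic division by X − a; the remainder f(a) is discarded.
  quotient : ∀ {m} → Carrier → Poly (suc m) → Poly m
  quotient {zero}  a f = []
  quotient {suc m} a f = eval F (tail f) a ∷ quotient a (tail f)

  cofactor : ∀ {m} → Carrier → Poly (suc m) → Carrier
  cofactor a f = eval F (quotient a f) a

  quotient-cong : ∀ {m} {f g : Poly (suc m)} → f ≗ g → ∀ a → quotient a f ≗ quotient a g
  quotient-cong {suc m} f≗g a zero    = eval-cong (λ i → f≗g (suc i)) a
  quotient-cong {suc m} f≗g a (suc j) = quotient-cong (λ i → f≗g (suc i)) a j

  cofactor-cong : ∀ {m} {f g : Poly (suc m)} → f ≗ g → ∀ a → cofactor a f ≡ cofactor a g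
  cofactor-cong f≗g a = eval-cong (quotient-cong f≗g a) a

  quotient-factor-suc : ∀ {m} a (f : Poly (suc m)) (j : Fin m) →
                        f (suc j) ≡ mulXminus F a (quotient a f) (suc j)
  quotient-factor-suc {suc zero}    a f zero    = sym (//-rightDividesʳ _ _)
  quotient-factor-suc {suc (suc m)} a f zero    = sym (//-rightDividesʳ _ _)
  quotient-factor-suc {suc (suc m)} a f (suc j) = quotient-factor-suc a (tail f) j

  quotient-factor : ∀ {m} {a} {f : Poly (suc m)} → Root F f a →
                    ∀ i → f i ≡ mulXminus F a (quotient a f) i
  quotient-factor {zero}  f[a]≡0 zero =
    trans (+-inverseˡ-unique _ _ f[a]≡0) (sym (+-identityˡ _))
  quotient-factor {suc m} f[a]≡0 zero =
    trans (+-inverseˡ-unique _ _ f[a]≡0) (sym (+-identityˡ _))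
  quotient-factor {a = a} {f} _ (suc j) = quotient-factor-suc a f j

  cofactor≢0⇒simpleRoot : ∀ {m} {a} {f : Poly (suc m)} → Root F f a → cofactor a f ≢ 0# →
                          SimpleRoot F f a
  cofactor≢0⇒simpleRoot f[a]≡0 q[a]≢0 = quotient _ _ , quotient-factor f[a]≡0 , q[a]≢0

  mulX : ∀ {m} → Poly m → Poly (suc m)
  mulX g = 0# ∷ g

  root-mulX : ∀ {m a} {g : Poly m} → Root F g a → Root F (mulX g) a
  root-mulX {a = a} {g} g[a]≡0 = begin
    0# + a * eval F g a  ≡⟨ cong (λ t → 0# + a * t) g[a]≡0 ⟩
    0# + a * 0#          ≡⟨ +-identityˡ _ ⟩
    a * 0#               ≡⟨ zeroʳ a ⟩
    0#                   ∎

  cofactor-mulX : ∀ {m a} {g : Poly (suc m)} → Root F g a →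
                  cofactor a (mulX g) ≡ a * cofactor a g
  cofactor-mulX {a = a} {g} g[a]≡0 = begin
    eval F g a + a * cofactor a g  ≡⟨ cong (_+ a * cofactor a g) g[a]≡0 ⟩
    0# + a * cofactor a g          ≡⟨ +-identityˡ _ ⟩
    a * cofactor a g               ∎

  cofactor-mulX≢0 : ∀ {m a} {g : Poly (suc m)} → a ≢ 0# → Root F g a → cofactor a g ≢ 0# →
                    cofactor a (mulX g) ≢ 0#
  cofactor-mulX≢0 {g = g} a≢0 g[a]≡0 q[a]≢0 =
    subst (_≢ 0#) (sym (cofactor-mulX {g = g} g[a]≡0)) (*-nonzero a≢0 q[a]≢0)

  X+1 : Poly 2
  X+1 = 1# ∷ 1# ∷ []

  Xᵏ⁺¹[X+1] : ∀ k → Poly (suc k +ℕ 2)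
  Xᵏ⁺¹[X+1] zero    = mulX X+1
  Xᵏ⁺¹[X+1] (suc k) = mulX (Xᵏ⁺¹[X+1] k)

  root-X+1 : Root F X+1 (- 1#)
  root-X+1 = begin
    1# + - 1# * (1# + - 1# * 0#)  ≡⟨ cong (λ t → 1# + - 1# * (1# + t)) (zeroʳ _) ⟩
    1# + - 1# * (1# + 0#)         ≡⟨ cong (λ t → 1# + - 1# * t) (+-identityʳ 1#) ⟩
    1# + - 1# * 1#                ≡⟨ cong (1# +_) (*-identityʳ _) ⟩
    1# + - 1#                     ≡⟨ -‿inverseʳ 1# ⟩
    0#                            ∎

  cofactor-X+1 : cofactor (- 1#) X+1 ≡ 1#
  cofactor-X+1 = begin
    (1# + - 1# * 0#) + - 1# * 0#  ≡⟨ cong₂ (λ s t → (1# + s) + t) (zeroʳ _) (zeroʳ _) ⟩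
    (1# + 0#) + 0#                ≡⟨ trans (+-identityʳ _) (+-identityʳ 1#) ⟩
    1#                            ∎

  root-Xᵏ⁺¹[X+1] : ∀ k → Root F (Xᵏ⁺¹[X+1] k) (- 1#)
  root-Xᵏ⁺¹[X+1] zero    = root-mulX {g = X+1} root-X+1
  root-Xᵏ⁺¹[X+1] (suc k) = root-mulX {g = Xᵏ⁺¹[X+1] k} (root-Xᵏ⁺¹[X+1] k)

  cofactor-Xᵏ⁺¹[X+1]≢0 : ∀ k → cofactor (- 1#) (Xᵏ⁺¹[X+1] k) ≢ 0#
  cofactor-Xᵏ⁺¹[X+1]≢0 zero    =
    cofactor-mulX≢0 {g = X+1} -1≢0 root-X+1 (subst (_≢ 0#) (sym cofactor-X+1) (0≢1 ∘ sym))
  cofactor-Xᵏ⁺¹[X+1]≢0 (suc k) =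
    cofactor-mulX≢0 {g = Xᵏ⁺¹[X+1] k} -1≢0
      (root-Xᵏ⁺¹[X+1] k) (cofactor-Xᵏ⁺¹[X+1]≢0 k)

  specialPoly-zeros : ∀ k → specialPoly F (VF.replicate (suc k) 0#) ≗ Xᵏ⁺¹[X+1] k
  specialPoly-zeros zero    zero    = refl
  specialPoly-zeros zero    (suc i) = refl
  specialPoly-zeros (suc k) zero    = refl
  specialPoly-zeros (suc k) (suc i) =
    trans (replicate-++-suc {m = suc k} 0# X+1 (suc i)) (specialPoly-zeros k i)

module Continuity {c ℓ : Level} (F : Field c) (T : FieldTopology F ℓ) where
  open Field F
  open FieldTopology T
  open Polynomials F using (quotient; cofactor)

  Vec : ℕ → Set c
  Vec = Vector Carrier

  everywhere : Pred Carrier c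
  everywhere _ = Lift c ⊤

  nbhd-everywhere : ∀ x → Nbhd x everywhere
  nbhd-everywhere x = everywhere , open-univ , lift tt , (λ x∈ → x∈)

  nbhd-mono : ∀ {x A B} → Nbhd x A → A ⊆ B → Nbhd x B
  nbhd-mono (O , O-open , x∈O , O⊆A) A⊆B = O , O-open , x∈O , (λ y∈O → A⊆B (O⊆A y∈O))

  nbhd-∩ : ∀ {x A B} → Nbhd x A → Nbhd x B → Nbhd x (A ∩ B)
  nbhd-∩ (O₁ , O₁-open , x∈O₁ , O₁⊆A) (O₂ , O₂-open , x∈O₂ , O₂⊆B) =
    O₁ ∩ O₂ , open-inter O₁ O₂ O₁-open O₂-open , (x∈O₁ , x∈O₂) ,
    (λ (y∈O₁ , y∈O₂) → O₁⊆A y∈O₁ , O₂⊆B y∈O₂)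

  nbhd-⋂ : ∀ {n x} {A : Fin n → Pred Carrier c} →
           (∀ i → Nbhd x (A i)) → Nbhd x (⋂ (Fin n) A)
  nbhd-⋂ {zero}  _      = nbhd-mono (nbhd-everywhere _) (λ _ ())
  nbhd-⋂ {suc n} nbhd-A =
    nbhd-mono (nbhd-∩ (nbhd-A zero) (nbhd-⋂ (λ i → nbhd-A (suc i))))
      (λ { (y∈A₀ , _) zero → y∈A₀ ; (_ , y∈A₊) (suc i) → y∈A₊ i })

  nbhd⇒∈ : ∀ {x A} → Nbhd x A → x ∈ A
  nbhd⇒∈ (_ , _ , x∈O , O⊆A) = O⊆A x∈O

  -- Neighbourhoods in Kⁿ are those of the product topology, generated by boxes ∏ᵢ V i.
  NbhdBox : ∀ {n} → Vec n → (Fin n → Pred Carrier c) → Set _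
  NbhdBox p V = ∀ i → Nbhd (p i) (V i)

  _∈ᵇ_ : ∀ {n} → Vec n → (Fin n → Pred Carrier c) → Set c
  v ∈ᵇ V = ∀ i → v i ∈ V i

  ContinuousAt : ∀ {n} → (Vec n → Carrier) → Vec n → Set _
  ContinuousAt φ p =
    ∀ W → Nbhd (φ p) W → ∃[ V ] (NbhdBox p V × (∀ v → v ∈ᵇ V → φ v ∈ W))

  ContinuousAtᵛ : ∀ {n m} → (Vec n → Vec m) → Vec n → Set _
  ContinuousAtᵛ f p = ∀ i → ContinuousAt (λ v → f v i) p

  ContinuousOp₂ : (Carrier → Carrier → Carrier) → Set _
  ContinuousOp₂ _∙_ = ∀ x y W → Nbhd (x ∙ y) W →
    ∃[ U ] ∃[ V ] (Nbhd x U × Nbhd y V × (∀ u v → u ∈ U → v ∈ V → (u ∙ v) ∈ W))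

  module _ {n} {p : Vec n} where

    const-continuousAt : ∀ a → ContinuousAt (λ _ → a) p
    const-continuousAt a W a∈W =
      (λ _ → everywhere) , (λ i → nbhd-everywhere (p i)) , (λ _ _ → nbhd⇒∈ a∈W)

    -- The box is W in coordinate j and everything elsewhere.
    proj-continuousAt : ∀ j → ContinuousAt (λ v → v j) p
    proj-continuousAt j W pⱼ∈W =
      (λ i y → i ≡ j → y ∈ W) , nbhd-box , (λ v v∈V → v∈V j refl)
      where
      nbhd-box : NbhdBox p (λ i y → i ≡ j → y ∈ W)
      nbhd-box i with i ≟ j
      ... | yes refl = nbhd-mono pⱼ∈W (λ y∈W _ → y∈W)
      ... | no  i≢j  = nbhd-mono (nbhd-everywhere (p i)) (λ _ i≡j → ⊥-elim (i≢j i≡j))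

    op-continuousAt : ∀ {_∙_} → ContinuousOp₂ _∙_ → ∀ {φ ψ} →
                      ContinuousAt φ p → ContinuousAt ψ p →
                      ContinuousAt (λ v → φ v ∙ ψ v) p
    op-continuousAt ∙-cont φ-cont ψ-cont W nbhd-W =
      let U , U′ , nbhd-U , nbhd-U′ , U∙U′⊆W = ∙-cont _ _ W nbhd-W
          V , nbhd-V , φ[V]⊆U = φ-cont U nbhd-U
          V′ , nbhd-V′ , ψ[V′]⊆U′ = ψ-cont U′ nbhd-U′
      in (λ i → V i ∩ V′ i) , (λ i → nbhd-∩ (nbhd-V i) (nbhd-V′ i)) ,
         (λ v v∈ → U∙U′⊆W _ _ (φ[V]⊆U v (λ i → proj₁ (v∈ i)))
                               (ψ[V′]⊆U′ v (λ i → proj₂ (v∈ i))))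

    eval-continuousAt : ∀ {m} (f : Vec n → Vec m) (g : Vec n → Carrier) →
                        ContinuousAtᵛ f p → ContinuousAt g p →
                        ContinuousAt (λ v → eval F (f v) (g v)) p
    eval-continuousAt {zero}  f g f-cont g-cont = const-continuousAt 0#
    eval-continuousAt {suc m} f g f-cont g-cont =
      op-continuousAt cont-+ (f-cont zero)
        (op-continuousAt cont-* g-cont
          (eval-continuousAt (λ v → tail (f v)) g (λ i → f-cont (suc i)) g-cont))

    quotient-continuousAt : ∀ {m} (f : Vec n → Vec (suc m)) (g : Vec n → Carrier) →
                            ContinuousAtᵛ f p → ContinuousAt g p →
                            ContinuousAtᵛ (λ v → quotient (g v) (f v)) p
    quotient-continuousAt {suc m} f g f-cont g-cont zero =
      eval-continuousAt (λ v → tail (f v)) g (λ i → f-cont (suc i)) g-cont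
    quotient-continuousAt {suc m} f g f-cont g-cont (suc j) =
      quotient-continuousAt (λ v → tail (f v)) g (λ i → f-cont (suc i)) g-cont j

    cofactor-continuousAt : ∀ {m} (f : Vec n → Vec (suc m)) (g : Vec n → Carrier) →
                            ContinuousAtᵛ f p → ContinuousAt g p →
                            ContinuousAt (λ v → cofactor (g v) (f v)) p
    cofactor-continuousAt f g f-cont g-cont =
      eval-continuousAt (λ v → quotient (g v) (f v)) g
        (quotient-continuousAt f g f-cont g-cont) g-cont

    ++-continuousAt : ∀ {m₁ m₂} (xs : Vec n → Vec m₁) (ys : Vec n → Vec m₂) →
                      ContinuousAtᵛ xs p → ContinuousAtᵛ ys p →
                      ContinuousAtᵛ (λ v → xs v ++ ys v) p
    ++-continuousAt {m₁} xs ys xs-cont ys-cont i with splitAt m₁ i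
    ... | inj₁ j = xs-cont j
    ... | inj₂ j = ys-cont j

    continuousAt⇒≢-nearby : ∀ {φ y} → ContinuousAt φ p → φ p ≢ y →
                            ∃[ V ] (NbhdBox p V × (∀ v → v ∈ᵇ V → φ v ≢ y))
    continuousAt⇒≢-nearby {φ} {y} φ-cont φ[p]≢y =
      let O , O′ , O-open , _ , φ[p]∈O , y∈O′ , O∩O′≡∅ = hausdorff (φ p) y φ[p]≢y
          V , nbhd-V , φ[V]⊆O = φ-cont O (O , O-open , φ[p]∈O , (λ z∈O → z∈O))
      in V , nbhd-V ,
         (λ v v∈V φ[v]≡y → O∩O′≡∅ y (subst (_∈ O) φ[v]≡y (φ[V]⊆O v v∈V)) y∈O′)

lemma1p10 : ∀ {c ℓ : Level} (F : Field c) (T : FieldTopology F ℓ) →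
            GtHenselian F T →
            ∀ (k : ℕ) (U : Pred (Field.Carrier F) c) →
            FieldTopology.Nbhd T (Field.-_ F (Field.1# F)) U →
            ∃[ V ] (FieldTopology.Nbhd T (Field.0# F) V ×
                    (∀ (cs : Fin (suc k) → Field.Carrier F) → (∀ i → cs i ∈ V) →
                     ∃[ x ] (x ∈ U × SimpleRoot F (specialPoly F cs) x)))
lemma1p10 F T gt-henselian k U nbhd-U =
  let V , nbhd-V , φ≢0 = continuousAt⇒≢-nearby φ-continuous φ[p]≢0
      V′ , nbhd-V′ , has-root = gt-henselian k (U ∩ V zero) (nbhd-∩ nbhd-U (nbhd-V zero))
  in V′ ∩ ⋂ _ (λ i → V (suc i)) , nbhd-∩ nbhd-V′ (nbhd-⋂ (λ i → nbhd-V (suc i))) ,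
     λ cs cs∈ →
       let x , (x∈U , x∈V₀) , root = has-root cs (λ i → proj₁ (cs∈ i))
       in x , x∈U , cofactor≢0⇒simpleRoot root
                      (φ≢0 (x ∷ cs) (λ { zero → x∈V₀ ; (suc i) → proj₂ (cs∈ i) i }))
  where
  open Field F
  open Polynomials F
  open Continuity F T

  p : Vec (suc (suc k))
  p = - 1# ∷ VF.replicate (suc k) 0#

  φ : Vec (suc (suc k)) → Carrier
  φ v = cofactor (head v) (specialPoly F (tail v))

  φ-continuous : ContinuousAt φ p
  φ-continuous = cofactor-continuousAt (λ v → specialPoly F (tail v)) head
    (++-continuousAt tail (λ _ → X+1)
      (λ i → proj-continuousAt (suc i)) (λ _ → const-continuousAt _))
    (proj-continuousAt zero)

  φ[p]≢0 : φ p ≢ 0#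
  φ[p]≢0 = subst (_≢ 0#) (sym (cofactor-cong (specialPoly-zeros k) (- 1#)))
             (cofactor-Xᵏ⁺¹[X+1]≢0 k)
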